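{- Let $p>0$ and $n\geq 4p$ be integers. Then there exists a pair $\mathcal{C},\mathcal{C}'$ of decompositions of the edge set of the complete graph $K_{8np+1}$ into cycles of length $4p$ which are orthogonal.
   Context: A decomposition of a graph into cycles of length $\ell$ is a set of cycles of length $\ell$ in the graph whose edge sets partition the edge set of the graph. Two cycle decompositions $\mathcal{C}$ and $\mathcal{C}'$ of the same graph are orthogonal if every cycle of $\mathcal{C}$ shares at most one edge with every cycle of $\mathcal{C}'$. -}

module Defs where

open import Data.Nat using (ℕ; zero; suc; _∸_; _≤_)
open import Data.Fin using (Fin; toℕ)
open import Data.Product using (Σ; ∃; ∃-syntax; _×_; _,_)
open import Data.Sum using (_⊎_)
open import Relation.Binary.PropositionalEquality using (_≡_; _≢_)
open import Function.Definitions using (Injective)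

-- The complete graph K_N has vertex set Fin N; its edges are the unordered
-- pairs {u , v} of distinct vertices.

SameEdge : ∀ {N} → Fin N → Fin N → Fin N → Fin N → Set
SameEdge a b c d = (a ≡ c × b ≡ d) ⊎ (a ≡ d × b ≡ c)

Consecutive : ∀ {ℓ} → Fin ℓ → Fin ℓ → Set
Consecutive {ℓ} i j = (toℕ j ≡ suc (toℕ i)) ⊎ (toℕ i ≡ ℓ ∸ 1 × toℕ j ≡ 0)

record Cycle (ℓ N : ℕ) : Set where
  field
    vertex   : Fin ℓ → Fin N
    distinct : Injective _≡_ _≡_ vertex

open Cycle public

HasEdge : ∀ {ℓ N} → Cycle ℓ N → Fin N → Fin N → Set
HasEdge C u v = ∃[ i ] ∃[ j ] (Consecutive i j × SameEdge (vertex C i) (vertex C j) u v)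

record Decomposition (ℓ N : ℕ) : Set where
  field
    size   : ℕ
    cycle  : Fin size → Cycle ℓ N
    cover  : ∀ (u v : Fin N) → u ≢ v → ∃[ k ] HasEdge (cycle k) u v
    unique : ∀ (u v : Fin N) (k k′ : Fin size) →
             HasEdge (cycle k) u v → HasEdge (cycle k′) u v → k ≡ k′

open Decomposition public

AtMostOneCommonEdge : ∀ {ℓ N} → Cycle ℓ N → Cycle ℓ N → Set
AtMostOneCommonEdge C D = ∀ a b c d →
  HasEdge C a b → HasEdge D a b → HasEdge C c d → HasEdge D c d → SameEdge a b c d

Orthogonal : ∀ {ℓ N} → Decomposition ℓ N → Decomposition ℓ N → Set
Orthogonal 𝒞 𝒞′ = ∀ k k′ → AtMostOneCommonEdge (cycle 𝒞 k) (cycle 𝒞′ k′)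

-- Identify the vertices of K_(2M+1) with ℤ_(2M+1) and give the edge xy the length ±(x − y) ∈ {1, …, M}.
-- If a family of base cycles uses every length exactly once, their translates decompose K_(2M+1): an edge
-- of length c lies in a translate of the unique base edge of length c, and 2c ≢ 0 forbids a second one.
-- A zigzag 4p-cycle alternating between the vertices s·λ(m) and a + s·(2p + m) has the edge lengths
-- a + s·x, 0 ≤ x < 4p, so every partition of {1, …, 4np} into n arithmetic progressions of 4p terms
-- yields a decomposition of K_(8np+1). Take the n blocks of consecutive integers and the n residue
-- classes modulo n: as 4p ≤ n a block meets a residue class at most once, and as every length occurs
-- in a single edge of each cycle, two cycles from the two decompositions share at most one edge.
module Submission where

open import Defs
open import Data.Empty using (⊥; ⊥-elim)
open import Data.Fin.Base as Fin using (Fin; toℕ; fromℕ<; combine; remQuot)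
import Data.Fin.Properties as Fin
open import Data.Nat.Base using (ℕ; zero; suc; pred; _+_; _*_; _∸_; _≤_; _<_; NonZero; z≤n; s≤s; s≤s⁻¹; z<s)
open import Data.Nat.DivMod
open import Data.Nat.Properties
open import Algebra.Properties.CommutativeSemigroup +-commutativeSemigroup using (x∙yz≈y∙xz; xy∙z≈xz∙y)
open import Data.Nat.Tactic.RingSolver using (solve-∀)
open import Data.Product using (_×_; _,_; proj₁; proj₂; ∃-syntax; ∃₂; uncurry)
open import Data.Sum using (_⊎_; inj₁; inj₂)
import Data.Sum as Sum
open import Function.Base using (_∘_; it)
open import Function.Definitions using (Injective)
open import Relation.Binary.Definitions using (tri<; tri≈; tri>)
open import Relation.Binary.PropositionalEquality
open import Relation.Nullary using (¬_; yes; no)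

module Modulo (N : ℕ) .{{_ : NonZero N}} where

  infix 4 _≈_
  _≈_ : ℕ → ℕ → Set
  x ≈ y = x % N ≡ y % N

  %-≈ : ∀ x → x % N ≈ x
  %-≈ x = m%n%n≡m%n x N

  +-cong-≈ : ∀ {a b c d} → a ≈ b → c ≈ d → a + c ≈ b + d
  +-cong-≈ {a} {b} {c} {d} a≈b c≈d = begin
    (a + c) % N             ≡⟨ %-distribˡ-+ a c N ⟩
    (a % N + c % N) % N     ≡⟨ cong₂ (λ x y → (x + y) % N) a≈b c≈d ⟩
    (b % N + d % N) % N     ≡⟨ %-distribˡ-+ b d N ⟨
    (b + d) % N             ∎
    where open ≡-Reasoning

  +-cancelʳ-≈ : ∀ a b c → a + c ≈ b + c → a ≈ b
  +-cancelʳ-≈ a b c a+c≈b+c = begin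
    a % N                            ≡⟨ [m+n]%n≡m%n a N ⟨
    (a + N) % N                      ≡⟨ cong (λ z → (a + z) % N) (m+[n∸m]≡n c%N≤N) ⟨
    (a + (c % N + k)) % N            ≡⟨ cong (_% N) (+-assoc a (c % N) k) ⟨
    (a + c % N + k) % N              ≡⟨ +-cong-≈ {a + c % N} {b + c % N} {k} {k} shifted refl ⟩
    (b + c % N + k) % N              ≡⟨ cong (_% N) (+-assoc b (c % N) k) ⟩
    (b + (c % N + k)) % N            ≡⟨ cong (λ z → (b + z) % N) (m+[n∸m]≡n c%N≤N) ⟩
    (b + N) % N                      ≡⟨ [m+n]%n≡m%n b N ⟩
    b % N                            ∎
    where
    open ≡-Reasoning
    k : ℕ
    k = N ∸ c % N
    c%N≤N : c % N ≤ N
    c%N≤N = m%n≤n c N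
    shifted : a + c % N ≈ b + c % N
    shifted = trans (+-cong-≈ {a} {a} refl (%-≈ c)) (trans a+c≈b+c (+-cong-≈ {b} {b} refl (sym (%-≈ c))))

  +-cancelˡ-≈ : ∀ a b c → c + a ≈ c + b → a ≈ b
  +-cancelˡ-≈ a b c c+a≈c+b =
    +-cancelʳ-≈ a b c (trans (cong (_% N) (+-comm a c)) (trans c+a≈c+b (cong (_% N) (+-comm c b))))

  ≈⇒≡ : ∀ {x y} → x < N → y < N → x ≈ y → x ≡ y
  ≈⇒≡ x<N y<N x≈y = trans (sym (m<n⇒m%n≡m x<N)) (trans x≈y (m<n⇒m%n≡m y<N))

  ≉0 : ∀ {x} → 0 < x → x < N → ¬ x ≈ 0
  ≉0 0<x x<N x≈0 = <⇒≢ 0<x (sym (≈⇒≡ x<N (≤-<-trans z≤n x<N) x≈0))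

module EdgeLength (M : ℕ) where

  N : ℕ
  N = suc (M + M)

  open Modulo N public

  Joins : ℕ → ℕ → ℕ → Set
  Joins c x y = x + c ≈ y ⊎ y + c ≈ x

  ≤M⇒<N : ∀ {x} → x ≤ M → x < N
  ≤M⇒<N x≤M = s≤s (≤-trans x≤M (m≤m+n M M))

  +≤M⇒<N : ∀ {c c′} → c ≤ M → c′ ≤ M → c + c′ < N
  +≤M⇒<N c≤M c′≤M = s≤s (+-mono-≤ c≤M c′≤M)

  private
    there-and-back : ∀ {c c′ x y} → 0 < c → c ≤ M → c′ ≤ M → x + c ≈ y → y + c′ ≈ x → ⊥
    there-and-back {c} {c′} {x} {y} 0<c c≤M c′≤M x+c≈y y+c′≈x =
      ≉0 (≤-trans 0<c (m≤m+n c c′)) (+≤M⇒<N c≤M c′≤M) (+-cancelˡ-≈ (c + c′) 0 x (begin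
        (x + (c + c′)) % N ≡⟨ cong (_% N) (+-assoc x c c′) ⟨
        (x + c + c′) % N   ≡⟨ +-cong-≈ {x + c} {y} {c′} {c′} x+c≈y refl ⟩
        (y + c′) % N       ≡⟨ y+c′≈x ⟩
        x % N              ≡⟨ cong (_% N) (+-identityʳ x) ⟨
        (x + 0) % N        ∎))
      where open ≡-Reasoning

  joins-unique : ∀ {c c′ x y} → 0 < c → c ≤ M → 0 < c′ → c′ ≤ M →
                 Joins c x y → Joins c′ x y → c ≡ c′
  joins-unique {c} {c′} {x} 0<c c≤M 0<c′ c′≤M (inj₁ x+c≈y) (inj₁ x+c′≈y) =
    ≈⇒≡ (≤M⇒<N c≤M) (≤M⇒<N c′≤M) (+-cancelˡ-≈ c c′ x (trans x+c≈y (sym x+c′≈y)))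
  joins-unique {c} {c′} {y = y} 0<c c≤M 0<c′ c′≤M (inj₂ y+c≈x) (inj₂ y+c′≈x) =
    ≈⇒≡ (≤M⇒<N c≤M) (≤M⇒<N c′≤M) (+-cancelˡ-≈ c c′ y (trans y+c≈x (sym y+c′≈x)))
  joins-unique {x = x} {y} 0<c c≤M 0<c′ c′≤M (inj₁ x+c≈y) (inj₂ y+c′≈x) =
    ⊥-elim (there-and-back {x = x} {y} 0<c c≤M c′≤M x+c≈y y+c′≈x)
  joins-unique {x = x} {y} 0<c c≤M 0<c′ c′≤M (inj₂ y+c≈x) (inj₁ x+c′≈y) =
    ⊥-elim (there-and-back {x = y} {x} 0<c c≤M c′≤M y+c≈x x+c′≈y)

  private
    joins-exists-< : ∀ {x y} → x < y → y < N → ∃[ c ] (0 < c × c ≤ M × Joins c x y)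
    joins-exists-< {x} {y} x<y y<N with y ∸ x ≤? M
    ... | yes d≤M = y ∸ x , m<n⇒0<n∸m x<y , d≤M , inj₁ (cong (_% N) (m+[n∸m]≡n (<⇒≤ x<y)))
    ... | no d≰M = N ∸ d , m<n⇒0<n∸m d<N , m≤n+o⇒m∸n≤o N d (+-monoˡ-≤ M (≰⇒> d≰M)) , inj₂ wraps
      where
      open ≡-Reasoning
      d : ℕ
      d = y ∸ x
      d<N : d < N
      d<N = ≤-<-trans (m∸n≤m y x) y<N
      wraps : y + (N ∸ d) ≈ x
      wraps = begin
        (y + (N ∸ d)) % N       ≡⟨ cong (λ z → (z + (N ∸ d)) % N) (m+[n∸m]≡n (<⇒≤ x<y)) ⟨
        (x + d + (N ∸ d)) % N   ≡⟨ cong (_% N) (+-assoc x d (N ∸ d)) ⟩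
        (x + (d + (N ∸ d))) % N ≡⟨ cong (λ z → (x + z) % N) (m+[n∸m]≡n (<⇒≤ d<N)) ⟩
        (x + N) % N             ≡⟨ [m+n]%n≡m%n x N ⟩
        x % N                   ∎

  joins-exists : ∀ {x y} → x < N → y < N → x ≢ y → ∃[ c ] (0 < c × c ≤ M × Joins c x y)
  joins-exists {x} {y} x<N y<N x≢y with <-cmp x y
  ... | tri< x<y _ _ = joins-exists-< x<y y<N
  ... | tri≈ _ x≡y _ = ⊥-elim (x≢y x≡y)
  ... | tri> _ _ y<x with joins-exists-< y<x x<N
  ...   | c , 0<c , c≤M , joins = c , 0<c , c≤M , Sum.swap joins

consecutive-exists : ∀ {L} (i : Fin L) → ∃[ i′ ] Consecutive i i′
consecutive-exists {suc L₀} i with suc (toℕ i) <? suc L₀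
... | yes 1+i<L = fromℕ< 1+i<L , inj₁ (Fin.toℕ-fromℕ< 1+i<L)
... | no 1+i≮L = Fin.zero , inj₂ (≤-antisym (s≤s⁻¹ (Fin.toℕ<n i)) (s≤s⁻¹ (≮⇒≥ 1+i≮L)) , refl)

consecutive-unique : ∀ {L} {i i′ i″ : Fin L} → Consecutive i i′ → Consecutive i i″ → i′ ≡ i″
consecutive-unique (inj₁ i′≡1+i) (inj₁ i″≡1+i) = Fin.toℕ-injective (trans i′≡1+i (sym i″≡1+i))
consecutive-unique (inj₂ (_ , i′≡0)) (inj₂ (_ , i″≡0)) = Fin.toℕ-injective (trans i′≡0 (sym i″≡0))
consecutive-unique {suc L₀} {i′ = i′} (inj₁ i′≡1+i) (inj₂ (i≡L₀ , _)) =
  ⊥-elim (<-irrefl (trans i′≡1+i (cong suc i≡L₀)) (Fin.toℕ<n i′))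
consecutive-unique {suc L₀} {i″ = i″} (inj₂ (i≡L₀ , _)) (inj₁ i″≡1+i) =
  ⊥-elim (<-irrefl (trans i″≡1+i (cong suc i≡L₀)) (Fin.toℕ<n i″))

SameEdge-sym : ∀ {N} {a b c d : Fin N} → SameEdge a b c d → SameEdge c d a b
SameEdge-sym (inj₁ (refl , refl)) = inj₁ (refl , refl)
SameEdge-sym (inj₂ (refl , refl)) = inj₂ (refl , refl)

SameEdge-trans : ∀ {N} {a b c d e f : Fin N} → SameEdge a b c d → SameEdge c d e f → SameEdge a b e f
SameEdge-trans (inj₁ (refl , refl)) cd≈ef = cd≈ef
SameEdge-trans (inj₂ (refl , refl)) (inj₁ (refl , refl)) = inj₂ (refl , refl)
SameEdge-trans (inj₂ (refl , refl)) (inj₂ (refl , refl)) = inj₁ (refl , refl)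

EdgeAt : ∀ {L N} → Cycle L N → Fin L → Fin N → Fin N → Set
EdgeAt C i u v = ∃[ i′ ] (Consecutive i i′ × SameEdge (vertex C i) (vertex C i′) u v)

edgeAt-unique : ∀ {L N} {C : Cycle L N} {i} {u v x y : Fin N} →
                EdgeAt C i u v → EdgeAt C i x y → SameEdge u v x y
edgeAt-unique (i′ , i→i′ , uv) (i″ , i→i″ , xy) rewrite consecutive-unique i→i′ i→i″ =
  SameEdge-trans (SameEdge-sym uv) xy

Difference : ℕ → ℕ → ℕ → Set
Difference c x y = x + c ≡ y ⊎ y + c ≡ x

record DifferenceFamily (M L : ℕ) : Set where
  field
    count             : ℕ
    label             : Fin count → Fin L → ℕ
    length            : Fin count → Fin L → ℕ
    label<            : ∀ j i → label j i < suc (M + M)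
    label-injective   : ∀ j → Injective _≡_ _≡_ (label j)
    length-pos        : ∀ j i → 0 < length j i
    length≤M          : ∀ j i → length j i ≤ M
    length-step       : ∀ j {i i′} → Consecutive i i′ → Difference (length j i) (label j i) (label j i′)
    length-injective  : ∀ {j j′ i i′} → length j i ≡ length j′ i′ → j ≡ j′ × i ≡ i′
    length-surjective : ∀ {c} → 0 < c → c ≤ M → ∃₂ λ j i → length j i ≡ c

module Translates {M L} (F : DifferenceFamily M L) where

  open DifferenceFamily F
  open EdgeLength M

  shift : Fin N → ℕ → Fin N
  shift t x = fromℕ< (m%n<n (x + toℕ t) N)

  toℕ-shift : ∀ t x → toℕ (shift t x) ≡ (x + toℕ t) % N
  toℕ-shift t x = Fin.toℕ-fromℕ< _

  toℕ-shift-≈ : ∀ t x → toℕ (shift t x) ≈ x + toℕ t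
  toℕ-shift-≈ t x = trans (cong (_% N) (toℕ-shift t x)) (%-≈ (x + toℕ t))

  shift-≈ : ∀ t t′ x y → shift t x ≡ shift t′ y → x + toℕ t ≈ y + toℕ t′
  shift-≈ t t′ x y eq = trans (sym (toℕ-shift t x)) (trans (cong toℕ eq) (toℕ-shift t′ y))

  shift-injectiveʳ : ∀ t {x y} → x < N → y < N → shift t x ≡ shift t y → x ≡ y
  shift-injectiveʳ t {x} {y} x<N y<N eq = ≈⇒≡ x<N y<N (+-cancelʳ-≈ x y (toℕ t) (shift-≈ t t x y eq))

  shift-injectiveˡ : ∀ {t t′} x → shift t x ≡ shift t′ x → t ≡ t′
  shift-injectiveˡ {t} {t′} x eq =
    Fin.toℕ-injective (≈⇒≡ (Fin.toℕ<n t) (Fin.toℕ<n t′) (+-cancelˡ-≈ (toℕ t) (toℕ t′) x (shift-≈ t t′ x x eq)))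

  translate : Fin count → Fin N → Cycle L N
  translate j t = record
    { vertex   = λ i → shift t (label j i)
    ; distinct = λ eq → label-injective j (shift-injectiveʳ t (label< j _) (label< j _) eq)
    }

  private
    shift-+ : ∀ t {c x y} → x + c ≡ y → toℕ (shift t x) + c ≈ toℕ (shift t y)
    shift-+ t {c} {x} {y} x+c≡y = begin
      (toℕ (shift t x) + c) % N  ≡⟨ +-cong-≈ {toℕ (shift t x)} {x + toℕ t} {c} (toℕ-shift-≈ t x) refl ⟩
      (x + toℕ t + c) % N        ≡⟨ cong (_% N) (xy∙z≈xz∙y x (toℕ t) c) ⟩
      (x + c + toℕ t) % N        ≡⟨ cong (λ z → (z + toℕ t) % N) x+c≡y ⟩
      (y + toℕ t) % N            ≡⟨ toℕ-shift-≈ t y ⟨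
      toℕ (shift t y) % N        ∎
      where open ≡-Reasoning

  shift-joins : ∀ t {c x y} → Difference c x y → Joins c (toℕ (shift t x)) (toℕ (shift t y))
  shift-joins t {c} {x} {y} (inj₁ x+c≡y) = inj₁ (shift-+ t {c} {x} {y} x+c≡y)
  shift-joins t {c} {x} {y} (inj₂ y+c≡x) = inj₂ (shift-+ t {c} {y} {x} y+c≡x)

  SameEdge-joins : ∀ {c} {x y u v : Fin N} → SameEdge x y u v →
                   Joins c (toℕ x) (toℕ y) → Joins c (toℕ u) (toℕ v)
  SameEdge-joins (inj₁ (refl , refl)) joins = joins
  SameEdge-joins (inj₂ (refl , refl)) joins = Sum.swap joins

  edge-length : ∀ {j t i u v} → EdgeAt (translate j t) i u v → Joins (length j i) (toℕ u) (toℕ v)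
  edge-length {j} {t} (i′ , i→i′ , same) = SameEdge-joins same (shift-joins t (length-step j i→i′))

  shift-onto : ∀ {c x y} (u v : Fin N) → x < N → x + c ≡ y → toℕ u + c ≈ toℕ v →
               ∃[ t ] (shift t x ≡ u × shift t y ≡ v)
  shift-onto {c} {x} {y} u v x<N x+c≡y u+c≈v = t , Fin.toℕ-injective tx≡u , Fin.toℕ-injective ty≡v
    where
    open ≡-Reasoning
    t : Fin N
    t = fromℕ< (m%n<n (toℕ u + (N ∸ x)) N)
    t≈u-x : toℕ t ≈ toℕ u + (N ∸ x)
    t≈u-x = trans (cong (_% N) (Fin.toℕ-fromℕ< (m%n<n (toℕ u + (N ∸ x)) N))) (%-≈ (toℕ u + (N ∸ x)))
    tx≡u : toℕ (shift t x) ≡ toℕ u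
    tx≡u = begin
      toℕ (shift t x)               ≡⟨ toℕ-shift t x ⟩
      (x + toℕ t) % N               ≡⟨ +-cong-≈ {x} {x} {toℕ t} refl t≈u-x ⟩
      (x + (toℕ u + (N ∸ x))) % N   ≡⟨ cong (_% N) (x∙yz≈y∙xz x (toℕ u) (N ∸ x)) ⟩
      (toℕ u + (x + (N ∸ x))) % N   ≡⟨ cong (λ z → (toℕ u + z) % N) (m+[n∸m]≡n (<⇒≤ x<N)) ⟩
      (toℕ u + N) % N               ≡⟨ [m+n]%n≡m%n (toℕ u) N ⟩
      toℕ u % N                     ≡⟨ m<n⇒m%n≡m (Fin.toℕ<n u) ⟩
      toℕ u                         ∎
    ty≡v : toℕ (shift t y) ≡ toℕ v
    ty≡v = ≈⇒≡ (Fin.toℕ<n (shift t y)) (Fin.toℕ<n v) (begin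
      toℕ (shift t y) % N           ≡⟨ shift-+ t {c} {x} {y} x+c≡y ⟨
      (toℕ (shift t x) + c) % N     ≡⟨ cong (λ z → (z + c) % N) tx≡u ⟩
      (toℕ u + c) % N               ≡⟨ u+c≈v ⟩
      toℕ v % N                     ∎)

  onto-edge : ∀ {c x y} {u v : Fin N} → x < N → y < N → Difference c x y → Joins c (toℕ u) (toℕ v) →
              ∃[ t ] SameEdge (shift t x) (shift t y) u v
  onto-edge {u = u} {v} x<N y<N (inj₁ x+c≡y) (inj₁ u+c≈v) with shift-onto u v x<N x+c≡y u+c≈v
  ... | t , x↦u , y↦v = t , inj₁ (x↦u , y↦v)
  onto-edge {u = u} {v} x<N y<N (inj₁ x+c≡y) (inj₂ v+c≈u) with shift-onto v u x<N x+c≡y v+c≈u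
  ... | t , x↦v , y↦u = t , inj₂ (x↦v , y↦u)
  onto-edge {u = u} {v} x<N y<N (inj₂ y+c≡x) (inj₁ u+c≈v) with shift-onto u v y<N y+c≡x u+c≈v
  ... | t , y↦u , x↦v = t , inj₂ (x↦v , y↦u)
  onto-edge {u = u} {v} x<N y<N (inj₂ y+c≡x) (inj₂ v+c≈u) with shift-onto v u y<N y+c≡x v+c≈u
  ... | t , y↦v , x↦u = t , inj₁ (x↦u , y↦v)

  -- Reversing an edge of length c by a translation would make c + c ≡ 0, impossible as 0 < 2c < N.
  no-reversal : ∀ {c x y} t t′ → 0 < c → c ≤ M → x + c ≡ y →
                shift t x ≡ shift t′ y → shift t y ≡ shift t′ x → ⊥
  no-reversal {c} {x} {y} t t′ 0<c c≤M x+c≡y tx≡t′y ty≡t′x =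
    ≉0 (≤-trans 0<c (m≤m+n c c)) (+≤M⇒<N c≤M c≤M) (+-cancelʳ-≈ (c + c) 0 (toℕ t′) (begin
      (c + c + toℕ t′) % N    ≡⟨ cong (_% N) (+-assoc c c (toℕ t′)) ⟩
      (c + (c + toℕ t′)) % N  ≡⟨ +-cong-≈ {c} {c} refl (sym t≈c+t′) ⟩
      (c + toℕ t) % N         ≡⟨ c+t≈t′ ⟩
      toℕ t′ % N              ∎))
    where
    open ≡-Reasoning
    t≈c+t′ : toℕ t ≈ c + toℕ t′
    t≈c+t′ = +-cancelˡ-≈ (toℕ t) (c + toℕ t′) x (begin
      (x + toℕ t) % N          ≡⟨ shift-≈ t t′ x y tx≡t′y ⟩
      (y + toℕ t′) % N         ≡⟨ cong (λ z → (z + toℕ t′) % N) x+c≡y ⟨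
      (x + c + toℕ t′) % N     ≡⟨ cong (_% N) (+-assoc x c (toℕ t′)) ⟩
      (x + (c + toℕ t′)) % N   ∎)
    c+t≈t′ : c + toℕ t ≈ toℕ t′
    c+t≈t′ = +-cancelˡ-≈ (c + toℕ t) (toℕ t′) x (begin
      (x + (c + toℕ t)) % N    ≡⟨ cong (_% N) (+-assoc x c (toℕ t)) ⟨
      (x + c + toℕ t) % N      ≡⟨ cong (λ z → (z + toℕ t) % N) x+c≡y ⟩
      (y + toℕ t) % N          ≡⟨ shift-≈ t t′ y x ty≡t′x ⟩
      (x + toℕ t′) % N         ∎)

  translate-unique : ∀ {j t t′ i u v} → EdgeAt (translate j t) i u v → EdgeAt (translate j t′) i u v → t ≡ t′
  translate-unique {j} {t} {t′} {i} (i′ , i→i′ , same) (i″ , i→i″ , same′)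
    rewrite consecutive-unique i→i″ i→i′
    with SameEdge-trans same (SameEdge-sym same′) | length-step j i→i′
  ... | inj₁ (x↦ , _)    | _          = shift-injectiveˡ (label j i) x↦
  ... | inj₂ (x↦y , y↦x) | inj₁ x+c≡y =
    ⊥-elim (no-reversal t t′ (length-pos j i) (length≤M j i) x+c≡y x↦y y↦x)
  ... | inj₂ (x↦y , y↦x) | inj₂ y+c≡x =
    ⊥-elim (no-reversal t t′ (length-pos j i) (length≤M j i) y+c≡x y↦x x↦y)

  translates-unique : ∀ {j j′ t t′ u v} → HasEdge (translate j t) u v → HasEdge (translate j′ t′) u v →
                      (j , t) ≡ (j′ , t′)
  translates-unique {j} {j′} {t} {t′} {u} {v} (i , edge) (i′ , edge′)
    with length-injective (joins-unique {x = toℕ u} {toℕ v} (length-pos j i) (length≤M j i)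
                                                            (length-pos j′ i′) (length≤M j′ i′)
                                        (edge-length {j} {t} edge) (edge-length {j′} {t′} edge′))
  ... | refl , refl = cong (j ,_) (translate-unique edge edge′)

  covered : ∀ {u v} → u ≢ v → ∃₂ λ j t → HasEdge (translate j t) u v
  covered {u} {v} u≢v with joins-exists (Fin.toℕ<n u) (Fin.toℕ<n v) (λ eq → u≢v (Fin.toℕ-injective eq))
  ... | c , 0<c , c≤M , joins with length-surjective 0<c c≤M
  ... | j , i , refl with consecutive-exists i
  ... | i′ , i→i′ with onto-edge (label< j i) (label< j i′) (length-step j i→i′) joins
  ... | t , same = j , t , i , i′ , i→i′ , same

  decomposition : Decomposition L N
  decomposition = record
    { size   = count * N
    ; cycle  = λ k → uncurry translate (remQuot {count} N k)
    ; cover  = covering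
    ; unique = λ u v k k′ edge edge′ → begin
        k                                      ≡⟨ Fin.combine-remQuot {count} N k ⟨
        uncurry combine (remQuot {count} N k)  ≡⟨ cong (uncurry combine) (translates-unique edge edge′) ⟩
        uncurry combine (remQuot {count} N k′) ≡⟨ Fin.combine-remQuot {count} N k′ ⟩
        k′                                     ∎
    }
    where
    open ≡-Reasoning
    covering : ∀ u v → u ≢ v → ∃[ k ] HasEdge (uncurry translate (remQuot {count} N k)) u v
    covering u v u≢v with covered u≢v
    ... | j , t , edge =
      combine j t , subst (λ p → HasEdge (uncurry translate p) u v) (sym (Fin.remQuot-combine j t)) edge

open DifferenceFamily using (length; length-pos; length≤M)

SharesAtMostOneLength : ∀ {M L} → DifferenceFamily M L → DifferenceFamily M L → Set
SharesAtMostOneLength F₁ F₂ = ∀ j j′ {i₁ i₂ i₃ i₄} →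
  length F₁ j i₁ ≡ length F₂ j′ i₂ → length F₁ j i₃ ≡ length F₂ j′ i₄ → i₁ ≡ i₃

orthogonal : ∀ {M L} (F₁ F₂ : DifferenceFamily M L) → SharesAtMostOneLength F₁ F₂ →
             Orthogonal (Translates.decomposition F₁) (Translates.decomposition F₂)
orthogonal {M} F₁ F₂ shares k k′ a b c d (i₁ , ab₁) (i₂ , ab₂) (i₃ , cd₁) (i₄ , cd₂) =
  same-position (shares j j′ (common-length ab₁ ab₂) (common-length cd₁ cd₂))
  where
  open EdgeLength M
  module T₁ = Translates F₁
  module T₂ = Translates F₂
  j : Fin (DifferenceFamily.count F₁)
  j = proj₁ (remQuot N k)
  t : Fin N
  t = proj₂ (remQuot {DifferenceFamily.count F₁} N k)
  j′ : Fin (DifferenceFamily.count F₂)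
  j′ = proj₁ (remQuot N k′)
  t′ : Fin N
  t′ = proj₂ (remQuot {DifferenceFamily.count F₂} N k′)
  common-length : ∀ {i i′ u v} → EdgeAt (T₁.translate j t) i u v → EdgeAt (T₂.translate j′ t′) i′ u v →
                  length F₁ j i ≡ length F₂ j′ i′
  common-length {i} {i′} {u} {v} e e′ =
    joins-unique {x = toℕ u} {toℕ v} (length-pos F₁ j i) (length≤M F₁ j i)
                                     (length-pos F₂ j′ i′) (length≤M F₂ j′ i′)
                 (T₁.edge-length {j} {t} e) (T₂.edge-length {j′} {t′} e′)
  same-position : i₁ ≡ i₃ → SameEdge a b c d
  same-position refl = edgeAt-unique {C = T₁.translate j t} ab₁ cd₁

interleave : (ℕ → ℕ) → (ℕ → ℕ) → ℕ → ℕ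
interleave f g zero          = f 0
interleave f g (suc zero)    = g 0
interleave f g (suc (suc i)) = interleave (f ∘ suc) (g ∘ suc) i

interleave-even : ∀ f g m → interleave f g (m + m) ≡ f m
interleave-even f g zero    = refl
interleave-even f g (suc m) rewrite +-suc m m = interleave-even (f ∘ suc) (g ∘ suc) m

interleave-odd : ∀ f g m → interleave f g (suc (m + m)) ≡ g m
interleave-odd f g zero    = refl
interleave-odd f g (suc m) rewrite +-suc m m = interleave-odd (f ∘ suc) (g ∘ suc) m

data EvenOdd : ℕ → Set where
  even : ∀ m → EvenOdd (m + m)
  odd  : ∀ m → EvenOdd (suc (m + m))

evenOdd : ∀ i → EvenOdd i
evenOdd zero = even 0
evenOdd (suc i) with evenOdd i
... | even m = odd m
... | odd m  = subst EvenOdd (cong suc (+-suc m m)) (even (suc m))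

half-≤ : ∀ {m h} → m + m ≤ suc (h + h) → m ≤ h
half-≤ {m} {h} 2m≤ with m ≤? h
... | yes m≤h = m≤h
... | no m≰h  = ⊥-elim (1+n≰n (≤-trans (≤-reflexive (cong suc (sym (+-suc h h))))
                                       (≤-trans (+-mono-≤ (≰⇒> m≰h) (≰⇒> m≰h)) 2m≤)))

half-< : ∀ {m h} → suc (m + m) ≤ h + h → m < h
half-< {m} {h} 2m<2h = ≰⇒> λ h≤m → 1+n≰n (≤-trans 2m<2h (+-mono-≤ h≤m h≤m))

m∸n+[n+o]≡m+o : ∀ {m n} o → n ≤ m → (m ∸ n) + (n + o) ≡ m + o
m∸n+[n+o]≡m+o {m} {n} o n≤m = trans (sym (+-assoc (m ∸ n) n o)) (cong (_+ o) (m∸n+n≡m n≤m))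

-- With p = q + 1: h = 2p − 1 and L = 4p. The even positions carry s·lower m, where lower lists
-- {0, …, 2p} ∖ {p} downwards, the odd positions carry a + s·upper m, and the edge leaving position i
-- has length a + s·σ i, where σ lists 0, …, 4p − 1 with h moved to the end.
module Zigzag (q : ℕ) where

  p h L₀ L : ℕ
  p  = suc q
  h  = q + p
  L₀ = suc (h + h)
  L  = suc L₀

  data Region (i : ℕ) : Set where
    bottom : i < h → Region i
    middle : h ≤ i → i < L₀ → Region i
    top    : i ≡ L₀ → Region i

  region : ∀ {i} → i < L → Region i
  region {i} i<L with i <? h | i <? L₀
  ... | yes i<h | _       = bottom i<h
  ... | no i≮h  | yes i<L₀ = middle (≮⇒≥ i≮h) i<L₀
  ... | no _    | no i≮L₀  = top (≤-antisym (s≤s⁻¹ i<L) (≮⇒≥ i≮L₀))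

  h<L₀ : h < L₀
  h<L₀ = s≤s (m≤m+n h h)

  σ : ℕ → ℕ
  σ i with i <? h | i <? L₀
  ... | yes _ | _     = i
  ... | no _  | yes _ = suc i
  ... | no _  | no _  = h

  σ-bottom : ∀ {i} → i < h → σ i ≡ i
  σ-bottom {i} i<h with i <? h
  ... | yes _  = refl
  ... | no i≮h = ⊥-elim (i≮h i<h)

  σ-middle : ∀ {i} → h ≤ i → i < L₀ → σ i ≡ suc i
  σ-middle {i} h≤i i<L₀ with i <? h | i <? L₀
  ... | yes i<h | _       = ⊥-elim (<⇒≱ i<h h≤i)
  ... | no _    | yes _   = refl
  ... | no _    | no i≮L₀ = ⊥-elim (i≮L₀ i<L₀)

  σ-top : σ L₀ ≡ h
  σ-top with L₀ <? h | L₀ <? L₀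
  ... | yes L₀<h | _      = ⊥-elim (<-asym L₀<h h<L₀)
  ... | no _     | yes L₀<L₀ = ⊥-elim (<-irrefl refl L₀<L₀)
  ... | no _     | no _   = refl

  σ⁻¹ : ℕ → ℕ
  σ⁻¹ x with x <? h | x ≟ h
  ... | yes _ | _     = x
  ... | no _  | yes _ = L₀
  ... | no _  | no _  = pred x

  σ⁻¹-bottom : ∀ {x} → x < h → σ⁻¹ x ≡ x
  σ⁻¹-bottom {x} x<h with x <? h
  ... | yes _  = refl
  ... | no x≮h = ⊥-elim (x≮h x<h)

  σ⁻¹-h : σ⁻¹ h ≡ L₀
  σ⁻¹-h with h <? h | h ≟ h
  ... | yes h<h | _      = ⊥-elim (<-irrefl refl h<h)
  ... | no _    | yes _  = refl
  ... | no _    | no h≢h = ⊥-elim (h≢h refl)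

  σ⁻¹-above : ∀ {x} → h < x → σ⁻¹ x ≡ pred x
  σ⁻¹-above {x} h<x with x <? h | x ≟ h
  ... | yes x<h | _       = ⊥-elim (<-asym x<h h<x)
  ... | no _    | yes x≡h = ⊥-elim (<-irrefl (sym x≡h) h<x)
  ... | no _    | no _    = refl

  σ<L : ∀ {i} → i < L → σ i < L
  σ<L i<L with region i<L
  ... | bottom i<h      = subst (_< L) (sym (σ-bottom i<h)) i<L
  ... | middle h≤i i<L₀ = subst (_< L) (sym (σ-middle h≤i i<L₀)) (s≤s i<L₀)
  ... | top refl        = subst (_< L) (sym σ-top) (<-trans h<L₀ (n<1+n L₀))

  σ⁻¹-σ : ∀ {i} → i < L → σ⁻¹ (σ i) ≡ i
  σ⁻¹-σ i<L with region i<L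
  ... | bottom i<h      rewrite σ-bottom i<h = σ⁻¹-bottom i<h
  ... | middle h≤i i<L₀ rewrite σ-middle h≤i i<L₀ = σ⁻¹-above (s≤s h≤i)
  ... | top refl        rewrite σ-top = σ⁻¹-h

  σ-σ⁻¹ : ∀ {x} → x < L → σ (σ⁻¹ x) ≡ x
  σ-σ⁻¹ {x} x<L with <-cmp x h
  ... | tri< x<h _ _ rewrite σ⁻¹-bottom x<h = σ-bottom x<h
  ... | tri≈ _ refl _ rewrite σ⁻¹-h = σ-top
  σ-σ⁻¹ {suc y} y<L₀ | tri> _ _ h<x rewrite σ⁻¹-above h<x = σ-middle (s≤s⁻¹ h<x) (s≤s⁻¹ y<L₀)

  σ⁻¹<L : ∀ {x} → x < L → σ⁻¹ x < L
  σ⁻¹<L {x} x<L with <-cmp x h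
  ... | tri< x<h _ _ rewrite σ⁻¹-bottom x<h = x<L
  ... | tri≈ _ refl _ rewrite σ⁻¹-h = n<1+n L₀
  σ⁻¹<L {suc y} y<L₀ | tri> _ _ h<x rewrite σ⁻¹-above h<x = <-trans (s≤s⁻¹ y<L₀) (n<1+n L₀)

  lower upper : ℕ → ℕ
  lower m with m <? p
  ... | yes _ = suc h ∸ m
  ... | no _  = h ∸ m
  upper m = suc h + m

  lower≤ : ∀ m → lower m ≤ suc h
  lower≤ m with m <? p
  ... | yes _ = m∸n≤m (suc h) m
  ... | no _  = ≤-trans (m∸n≤m h m) (n≤1+n h)

  private
    lower-across : ∀ {m m′} → m < p → p ≤ m′ → m′ ≤ h → suc h ∸ m ≢ h ∸ m′
    lower-across {m} {m′} m<p p≤m′ m′≤h eq =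
      <⇒≢ (<-≤-trans m<p (≤-trans p≤m′ (n≤1+n m′))) (+-cancelˡ-≡ (h ∸ m′) m (suc m′) (begin
        (h ∸ m′) + m        ≡⟨ cong (_+ m) eq ⟨
        (suc h ∸ m) + m     ≡⟨ m∸n+n≡m (m≤n⇒m≤1+n (<⇒≤ (<-≤-trans m<p (m≤n+m p q)))) ⟩
        suc h               ≡⟨ cong suc (m∸n+n≡m m′≤h) ⟨
        suc (h ∸ m′ + m′)   ≡⟨ +-suc (h ∸ m′) m′ ⟨
        (h ∸ m′) + suc m′   ∎))
      where open ≡-Reasoning

  lower-injective : ∀ {m m′} → m ≤ h → m′ ≤ h → lower m ≡ lower m′ → m ≡ m′
  lower-injective {m} {m′} m≤h m′≤h eq with m <? p | m′ <? p
  ... | yes _   | yes _    = ∸-cancelˡ-≡ (m≤n⇒m≤1+n m≤h) (m≤n⇒m≤1+n m′≤h) eq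
  ... | no _    | no _     = ∸-cancelˡ-≡ m≤h m′≤h eq
  ... | yes m<p | no m′≮p  = ⊥-elim (lower-across m<p (≮⇒≥ m′≮p) m′≤h eq)
  ... | no m≮p  | yes m′<p = ⊥-elim (lower-across m′<p (≮⇒≥ m≮p) m≤h (sym eq))

  private
    h≤2m : ∀ {m} → p ≤ m → h ≤ m + m
    h≤2m {m} p≤m = +-mono-≤ (≤-trans (n≤1+n q) p≤m) p≤m

    h≤2m+1 : ∀ {m} → p ≤ suc m → h ≤ suc (m + m)
    h≤2m+1 {m} p≤1+m = ≤-trans (+-mono-≤ (s≤s⁻¹ p≤1+m) p≤1+m) (≤-reflexive (+-suc m m))

  lower+σ-even : ∀ {m} → m ≤ h → lower m + σ (m + m) ≡ upper m
  lower+σ-even {m} m≤h with m <? p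
  ... | yes m<p rewrite σ-bottom (+-mono-≤-< (s≤s⁻¹ m<p) m<p) = m∸n+[n+o]≡m+o m (m≤n⇒m≤1+n m≤h)
  ... | no m≮p  rewrite σ-middle (h≤2m (≮⇒≥ m≮p)) (s≤s (+-mono-≤ m≤h m≤h)) =
    trans (+-suc (h ∸ m) (m + m)) (cong suc (m∸n+[n+o]≡m+o m m≤h))

  lower+σ-odd : ∀ {m} → m < h → lower (suc m) + σ (suc (m + m)) ≡ upper m
  lower+σ-odd {m} m<h with suc m <? p
  ... | yes 1+m<p rewrite σ-bottom (+-mono-≤-< (s≤s⁻¹ 1+m<p) (<-trans (n<1+n m) 1+m<p)) =
    m∸n+[n+o]≡m+o m (s≤s (<⇒≤ m<h))
  ... | no 1+m≮p rewrite σ-middle (h≤2m+1 (≮⇒≥ 1+m≮p)) (s≤s (+-mono-< m<h m<h)) = begin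
      (h ∸ suc m) + suc (suc (m + m))   ≡⟨ cong (λ z → (h ∸ suc m) + suc z) (+-suc m m) ⟨
      (h ∸ suc m) + (suc m + suc m)     ≡⟨ m∸n+[n+o]≡m+o (suc m) m<h ⟩
      h + suc m                         ≡⟨ +-suc h m ⟩
      suc h + m                         ∎
    where open ≡-Reasoning

  lower+σ-top : lower 0 + σ L₀ ≡ upper h
  lower+σ-top rewrite σ-top = refl

  label : ℕ → ℕ → ℕ → ℕ
  label a s = interleave (λ m → s * lower m) (λ m → a + s * upper m)

  label-even : ∀ a s m → label a s (m + m) ≡ s * lower m
  label-even a s = interleave-even (λ m → s * lower m) (λ m → a + s * upper m)

  label-odd : ∀ a s m → label a s (suc (m + m)) ≡ a + s * upper m
  label-odd a s = interleave-odd (λ m → s * lower m) (λ m → a + s * upper m)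

  label-after-odd : ∀ a s m → label a s (suc (suc (m + m))) ≡ s * lower (suc m)
  label-after-odd a s = interleave-even (λ m → s * lower (suc m)) (λ m → a + s * upper (suc m))

  private
    scaled : ∀ a s {l e u} → l + e ≡ u → s * l + (a + s * e) ≡ a + s * u
    scaled a s {l} {e} refl = distrib a s l e
      where
      distrib : ∀ a s l e → s * l + (a + s * e) ≡ a + s * (l + e)
      distrib = solve-∀

    even-half : ∀ {m} → m + m < L → m ≤ h
    even-half 2m<L = half-≤ (s≤s⁻¹ 2m<L)

    odd-half : ∀ {m} → suc (m + m) < L → m ≤ h
    odd-half {m} 2m+1<L = half-≤ (≤-trans (n≤1+n (m + m)) (s≤s⁻¹ 2m+1<L))

  label-step : ∀ a s {i} → i < L₀ → Difference (a + s * σ i) (label a s i) (label a s (suc i))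
  label-step a s {i} i<L₀ with evenOdd i
  ... | even m rewrite label-even a s m | label-odd a s m =
    inj₁ (scaled a s (lower+σ-even (half-≤ (<⇒≤ i<L₀))))
  ... | odd m  rewrite label-odd a s m | label-after-odd a s m =
    inj₂ (scaled a s (lower+σ-odd (half-< (s≤s⁻¹ i<L₀))))

  label-close : ∀ a s → Difference (a + s * σ L₀) (label a s L₀) (label a s 0)
  label-close a s rewrite label-odd a s h =
    inj₂ (scaled a s lower+σ-top)

  label≤ : ∀ a s {i} → i < L → label a s i ≤ a + s * L₀
  label≤ a s {i} i<L with evenOdd i
  ... | even m rewrite label-even a s m =
    ≤-trans (*-monoʳ-≤ s (≤-trans (lower≤ m) (s≤s (m≤m+n h h)))) (m≤n+m (s * L₀) a)
  ... | odd m  rewrite label-odd a s m =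
    +-monoʳ-≤ a (*-monoʳ-≤ s (+-monoʳ-≤ (suc h) (odd-half i<L)))

  module _ {a s} (0<a : 0 < a) .{{_ : NonZero s}} where

    private
      lower<upper : ∀ m m′ → s * lower m < a + s * upper m′
      lower<upper m m′ = ≤-<-trans (*-monoʳ-≤ s (≤-trans (lower≤ m) (m≤m+n (suc h) m′))) (m<n+m (s * upper m′) 0<a)

    label-injective : ∀ {i i′} → i < L → i′ < L → label a s i ≡ label a s i′ → i ≡ i′
    label-injective {i} {i′} i<L i′<L eq with evenOdd i | evenOdd i′
    ... | even m | even m′ rewrite label-even a s m | label-even a s m′ =
      cong (λ x → x + x) (lower-injective (even-half {m} i<L) (even-half {m′} i′<L) (*-cancelˡ-≡ (lower m) (lower m′) s eq))
    ... | odd m | odd m′ rewrite label-odd a s m | label-odd a s m′ =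
      cong (λ x → suc (x + x)) (+-cancelˡ-≡ (suc h) m m′ (*-cancelˡ-≡ (upper m) (upper m′) s (+-cancelˡ-≡ a _ _ eq)))
    ... | even m | odd m′ rewrite label-even a s m | label-odd a s m′ =
      ⊥-elim (<-irrefl eq (lower<upper m m′))
    ... | odd m | even m′ rewrite label-odd a s m | label-even a s m′ =
      ⊥-elim (<-irrefl (sym eq) (lower<upper m′ m))

record ProgressionPartition (M L : ℕ) : Set where
  field
    count        : ℕ
    start step   : Fin count → ℕ
  term : Fin count → ℕ → ℕ
  term j x = start j + step j * x
  field
    start-pos    : ∀ j → 0 < start j
    step-nonZero : ∀ j → NonZero (step j)
    term≤M       : ∀ j {x} → x < L → term j x ≤ M
    covers       : ∀ {c} → 0 < c → c ≤ M → ∃₂ λ j x → x < L × term j x ≡ c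
    disjoint     : ∀ {j j′ x x′} → x < L → x′ < L → term j x ≡ term j′ x′ → j ≡ j′

MeetAtMostOnce : ∀ {M L} → ProgressionPartition M L → ProgressionPartition M L → Set
MeetAtMostOnce {L = L} P₁ P₂ = ∀ j j′ {x₁ x₂ y₁ y₂} → x₁ < L → x₂ < L →
  P₁.term j x₁ ≡ P₂.term j′ y₁ → P₁.term j x₂ ≡ P₂.term j′ y₂ → x₁ ≡ x₂
  where
  module P₁ = ProgressionPartition P₁
  module P₂ = ProgressionPartition P₂

module ZigzagFamily (q : ℕ) where

  open Zigzag q

  family : ∀ {M} → ProgressionPartition M L → DifferenceFamily M L
  family {M} P = record
    { count             = count
    ; label             = λ j i → label (start j) (step j) (toℕ i)
    ; length            = λ j i → term j (σ (toℕ i))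
    ; label<            = λ j i → s≤s (≤-trans (≤-trans (label≤ (start j) (step j) (Fin.toℕ<n i)) (term≤M j (n<1+n L₀)))
                                                (m≤m+n M M))
    ; label-injective   = λ j eq → Fin.toℕ-injective
                            (label-injective (start-pos j) {{step-nonZero j}} (Fin.toℕ<n _) (Fin.toℕ<n _) eq)
    ; length-pos        = λ j i → ≤-trans (start-pos j) (m≤m+n (start j) _)
    ; length≤M          = λ j i → term≤M j (σ<L (Fin.toℕ<n i))
    ; length-step       = step-of
    ; length-injective  = injective
    ; length-surjective = surjective
    }
    where
    open ProgressionPartition P

    step-of : ∀ j {i i′ : Fin L} → Consecutive i i′ →
              Difference (term j (σ (toℕ i))) (label (start j) (step j) (toℕ i)) (label (start j) (step j) (toℕ i′))
    step-of j {i} {i′} (inj₁ i′≡1+i) rewrite i′≡1+i =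
      label-step (start j) (step j) (s≤s⁻¹ (subst (_< L) i′≡1+i (Fin.toℕ<n i′)))
    step-of j (inj₂ (i≡L₀ , i′≡0)) rewrite i≡L₀ | i′≡0 = label-close (start j) (step j)

    injective : ∀ {j j′} {i i′ : Fin L} → term j (σ (toℕ i)) ≡ term j′ (σ (toℕ i′)) → j ≡ j′ × i ≡ i′
    injective {j} {j′} {i} {i′} eq with disjoint (σ<L (Fin.toℕ<n i)) (σ<L (Fin.toℕ<n i′)) eq
    ... | refl = refl , Fin.toℕ-injective (begin
      toℕ i             ≡⟨ σ⁻¹-σ (Fin.toℕ<n i) ⟨
      σ⁻¹ (σ (toℕ i))   ≡⟨ cong σ⁻¹ (*-cancelˡ-≡ _ _ (step j) {{step-nonZero j}} (+-cancelˡ-≡ (start j) _ _ eq)) ⟩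
      σ⁻¹ (σ (toℕ i′))  ≡⟨ σ⁻¹-σ (Fin.toℕ<n i′) ⟩
      toℕ i′            ∎)
      where open ≡-Reasoning

    surjective : ∀ {c} → 0 < c → c ≤ M → ∃₂ λ j (i : Fin L) → term j (σ (toℕ i)) ≡ c
    surjective 0<c c≤M with covers 0<c c≤M
    ... | j , x , x<L , refl = j , fromℕ< (σ⁻¹<L x<L) ,
      cong (term j) (trans (cong σ (Fin.toℕ-fromℕ< (σ⁻¹<L x<L))) (σ-σ⁻¹ x<L))

  family-sharesAtMostOneLength : ∀ {M} (P₁ P₂ : ProgressionPartition M L) → MeetAtMostOnce P₁ P₂ →
                                 SharesAtMostOneLength (family P₁) (family P₂)
  family-sharesAtMostOneLength P₁ P₂ meet j j′ {i₁} {i₂} {i₃} {i₄} eq₁ eq₃ =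
    Fin.toℕ-injective (trans (sym (σ⁻¹-σ (Fin.toℕ<n i₁)))
      (trans (cong σ⁻¹ (meet j j′ {y₁ = σ (toℕ i₂)} {σ (toℕ i₄)} (σ<L (Fin.toℕ<n i₁)) (σ<L (Fin.toℕ<n i₃)) eq₁ eq₃))
             (σ⁻¹-σ (Fin.toℕ<n i₃))))

divMod-unique : ∀ d .{{_ : NonZero d}} {r r′ k k′} → r < d → r′ < d → r + k * d ≡ r′ + k′ * d → r ≡ r′ × k ≡ k′
divMod-unique d {r} {r′} {k} {k′} r<d r′<d eq =
  r≡r′ , *-cancelʳ-≡ k k′ d (+-cancelˡ-≡ r _ _ (trans eq (cong (_+ k′ * d) (sym r≡r′))))
  where
  open ≡-Reasoning
  r≡r′ : r ≡ r′
  r≡r′ = begin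
    r                   ≡⟨ m<n⇒m%n≡m r<d ⟨
    r % d               ≡⟨ [m+kn]%n≡m%n r k d ⟨
    (r + k * d) % d     ≡⟨ cong (_% d) eq ⟩
    (r′ + k′ * d) % d   ≡⟨ [m+kn]%n≡m%n r′ k′ d ⟩
    r′ % d              ≡⟨ m<n⇒m%n≡m r′<d ⟩
    r′                  ∎

blocks : ∀ n L .{{_ : NonZero L}} → ProgressionPartition (n * L) L
blocks n L = record
  { count        = n
  ; start        = λ j → suc (toℕ j * L)
  ; step         = λ _ → 1
  ; start-pos    = λ _ → z<s
  ; step-nonZero = λ _ → _
  ; term≤M       = λ j {x} x<L → subst (_≤ n * L) (sym (term≡ j x))
                                   (≤-trans (+-monoˡ-≤ (toℕ j * L) x<L) (*-monoˡ-≤ L (Fin.toℕ<n j)))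
  ; covers       = covers
  ; disjoint     = λ {j} {j′} {x} {x′} x<L x′<L eq → Fin.toℕ-injective
                     (proj₂ (divMod-unique L x<L x′<L
                       (suc-injective (trans (sym (term≡ j x)) (trans eq (term≡ j′ x′))))))
  }
  where
  term≡ : ∀ (j : Fin n) x → suc (toℕ j * L) + 1 * x ≡ suc (x + toℕ j * L)
  term≡ j x = cong suc (rearrange (toℕ j) L x)
    where
    rearrange : ∀ j L x → j * L + 1 * x ≡ x + j * L
    rearrange = solve-∀
  covers : ∀ {c} → 0 < c → c ≤ n * L → ∃₂ λ (j : Fin n) x → x < L × suc (toℕ j * L) + 1 * x ≡ c
  covers {suc c} _ c<nL = fromℕ< c/L<n , c % L , m%n<n c L , (begin
      suc (toℕ (fromℕ< c/L<n) * L) + 1 * (c % L)   ≡⟨ term≡ (fromℕ< c/L<n) (c % L) ⟩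
      suc (c % L + toℕ (fromℕ< c/L<n) * L)         ≡⟨ cong (λ z → suc (c % L + z * L)) (Fin.toℕ-fromℕ< c/L<n) ⟩
      suc (c % L + c / L * L)                      ≡⟨ cong suc (m≡m%n+[m/n]*n c L) ⟨
      suc c                                        ∎)
    where
    open ≡-Reasoning
    c/L<n : c / L < n
    c/L<n = m<n*o⇒m/o<n c<nL

residues : ∀ n L {{_ : NonZero n}} → ProgressionPartition (n * L) L
residues n L = record
  { count        = n
  ; start        = λ j → suc (toℕ j)
  ; step         = λ _ → n
  ; start-pos    = λ _ → z<s
  ; step-nonZero = λ _ → it
  ; term≤M       = λ j {x} x<L → ≤-trans (+-monoˡ-≤ (n * x) (Fin.toℕ<n j))
                                          (≤-trans (≤-reflexive (sym (*-suc n x))) (*-monoʳ-≤ n x<L))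
  ; covers       = covers
  ; disjoint     = λ {j} {j′} {x} {x′} _ _ eq → Fin.toℕ-injective
                     (proj₁ (divMod-unique n {k = x} {x′} (Fin.toℕ<n j) (Fin.toℕ<n j′)
                       (suc-injective (trans (sym (term≡ j x)) (trans eq (term≡ j′ x′))))))
  }
  where
  term≡ : ∀ (j : Fin n) x → suc (toℕ j) + n * x ≡ suc (toℕ j + x * n)
  term≡ j x = cong (λ z → suc (toℕ j + z)) (*-comm n x)
  covers : ∀ {c} → 0 < c → c ≤ n * L → ∃₂ λ (j : Fin n) x → x < L × suc (toℕ j) + n * x ≡ c
  covers {suc c} _ c<nL = fromℕ< (m%n<n c n) , c / n , m<n*o⇒m/o<n (subst (c <_) (*-comm n L) c<nL) , (begin
      suc (toℕ (fromℕ< (m%n<n c n))) + n * (c / n)   ≡⟨ term≡ (fromℕ< (m%n<n c n)) (c / n) ⟩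
      suc (toℕ (fromℕ< (m%n<n c n)) + c / n * n)     ≡⟨ cong (λ z → suc (z + c / n * n)) (Fin.toℕ-fromℕ< (m%n<n c n)) ⟩
      suc (c % n + c / n * n)                        ≡⟨ cong suc (m≡m%n+[m/n]*n c n) ⟨
      suc c                                          ∎)
    where open ≡-Reasoning

private
  later-term-escapes : ∀ {A B n x x′ y y′} → x′ < n → A + x ≡ B + n * y → A + x′ ≡ B + n * y′ → y < y′ → ⊥
  later-term-escapes {A} {B} {n} {x} {x′} {y} {y′} x′<n eq eq′ y<y′ = <-irrefl refl (begin-strict
    A + n             ≤⟨ +-monoˡ-≤ n (m≤m+n A x) ⟩
    A + x + n         ≡⟨ cong (_+ n) eq ⟩
    B + n * y + n     ≡⟨ next-term B n y ⟩
    B + n * suc y     ≤⟨ +-monoʳ-≤ B (*-monoʳ-≤ n y<y′) ⟩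
    B + n * y′        ≡⟨ eq′ ⟨
    A + x′            <⟨ +-monoʳ-< A x′<n ⟩
    A + n             ∎)
    where
    open ≤-Reasoning
    next-term : ∀ B n y → B + n * y + n ≡ B + n * suc y
    next-term = solve-∀

window-progression-unique : ∀ {A B n x x′ y y′} → x < n → x′ < n →
                            A + x ≡ B + n * y → A + x′ ≡ B + n * y′ → x ≡ x′
window-progression-unique {A} {y = y} {y′} x<n x′<n eq eq′ with <-cmp y y′
... | tri< y<y′ _ _ = ⊥-elim (later-term-escapes x′<n eq eq′ y<y′)
... | tri≈ _ refl _ = +-cancelˡ-≡ A _ _ (trans eq (sym eq′))
... | tri> _ _ y′<y = ⊥-elim (later-term-escapes x<n eq′ eq y′<y)

blocks-residues-meetAtMostOnce : ∀ n L {{_ : NonZero n}} .{{_ : NonZero L}} → L ≤ n →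
                                 MeetAtMostOnce (blocks n L) (residues n L)
blocks-residues-meetAtMostOnce n L L≤n j j′ {x₁} {x₂} x₁<L x₂<L eq₁ eq₂ =
  window-progression-unique (<-≤-trans x₁<L L≤n) (<-≤-trans x₂<L L≤n)
    (trans (cong (suc (toℕ j * L) +_) (sym (*-identityˡ x₁))) eq₁)
    (trans (cong (suc (toℕ j * L) +_) (sym (*-identityˡ x₂))) eq₂)

orthogonal-decompositions : ∀ q n {{_ : NonZero n}} → let L = Zigzag.L q in L ≤ n →
                            ∃[ 𝒞 ] ∃[ 𝒞′ ] Orthogonal {L} {suc (n * L + n * L)} 𝒞 𝒞′
orthogonal-decompositions q n L≤n =
  Translates.decomposition cyclic₁ , Translates.decomposition cyclic₂ ,
  orthogonal cyclic₁ cyclic₂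
    (family-sharesAtMostOneLength (blocks n L) (residues n L) (blocks-residues-meetAtMostOnce n L L≤n))
  where
  open Zigzag q using (L)
  open ZigzagFamily q
  cyclic₁ cyclic₂ : DifferenceFamily (n * L) L
  cyclic₁ = family (blocks n L)
  cyclic₂ = family (residues n L)

corollary1p5 : ∀ (p n : ℕ) → 0 < p → 4 * p ≤ n →
    ∃[ 𝒞 ] ∃[ 𝒞′ ] Orthogonal {4 * p} {8 * n * p + 1} 𝒞 𝒞′
corollary1p5 (suc q) n@(suc _) _ 4p≤n =
  subst₂ (λ L N → ∃[ 𝒞 ] ∃[ 𝒞′ ] Orthogonal {L} {N} 𝒞 𝒞′) L≡4p N≡8np+1
         (orthogonal-decompositions q n (subst (_≤ n) (sym L≡4p) 4p≤n))
  where
  L≡4p : Zigzag.L q ≡ 4 * suc q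
  L≡4p = length-formula q
    where
    length-formula : ∀ q → suc (suc ((q + suc q) + (q + suc q))) ≡ 4 * suc q
    length-formula = solve-∀
  N≡8np+1 : suc (n * Zigzag.L q + n * Zigzag.L q) ≡ 8 * n * suc q + 1
  N≡8np+1 = trans (cong (λ L → suc (n * L + n * L)) L≡4p) (order-formula n q)
    where
    order-formula : ∀ n q → suc (n * (4 * suc q) + n * (4 * suc q)) ≡ 8 * n * suc q + 1
    order-formula = solve-∀
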